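{- Let $n\ge 2$ and $d\ge1$ be integers, let $G=\mathbb{Z}_n^d$, and let $A$ be a non-empty subset of $\{1,\dots,n\}$. If $s_A(G)=d_A(G)+n-1$, then $ZS_A(G)=d_A(G)+n^d-1$.
   Context: $\mathbb{Z}_n^d$ is the direct sum of $d$ copies of $\mathbb{Z}/n\mathbb{Z}$ (exponent $n$). For a finite abelian group $G$ of exponent $n$ and non-empty $A\subseteq\{1,\dots,n\}$: $d_A(G)$ is the least positive integer $t$ such that every sequence $(g_1,\dots,g_t)$ of elements of $G$ has a non-empty subsequence $g_{i_1},\dots,g_{i_\ell}$ (distinct indices) and $a_1,\dots,a_\ell\in A$ with $\sum_j a_j g_{i_j}=0$. $ZS_A(G)$ (resp. $s_A(G)$) is the least positive integer $t$ such that every sequence of $t$ elements of $G$ has a subsequence $g_{i_1},\dots,g_{i_m}$ (distinct indices) of length exactly $m=|G|$ (resp. $m=n$) and $a_1,\dots,a_m\in A$ (not necessarily distinct) with $\sum_{j=1}^m a_j g_{i_j}=0$ in $G$. -}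

module Defs where

open import Data.Nat using (ℕ; zero; suc; _+_; _*_; _≤_; _<_; _^_)
open import Data.Nat.Divisibility using (_∣_)
open import Data.Fin using (Fin; toℕ)
import Data.Fin as F
open import Data.Product using (Σ; ∃; _×_; _,_)
open import Function.Definitions using (Injective)
open import Relation.Binary.PropositionalEquality using (_≡_)

Σ[<_]_ : (m : ℕ) → (Fin m → ℕ) → ℕ
Σ[< zero ] f = 0
Σ[< suc m ] f = f F.zero + Σ[< m ] (λ i → f (F.suc i))

-- Elements of G = ℤ_n^d : a coordinate vector Fin d → Fin n (residues 0..n-1).
Grp : ℕ → ℕ → Set
Grp n d = Fin d → Fin n

Seq : ℕ → ℕ → ℕ → Set
Seq n d t = Fin t → Grp n d

record WeightSet (n : ℕ) : Set₁ where
  field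
    mem      : ℕ → Set
    inRange  : ∀ a → mem a → 1 ≤ a × a ≤ n
    nonEmpty : ∃ λ a → mem a

open WeightSet public

WeightedZero : ∀ {n d t ℓ} → Seq n d t → (Fin ℓ → Fin t) → (Fin ℓ → ℕ) → Set
WeightedZero {n} {d} {t} {ℓ} g ι a =
  ∀ (k : Fin d) → n ∣ Σ[< ℓ ] (λ j → a j * toℕ (g (ι j) k))

HasAZeroSubseq : ∀ {n d t} → WeightSet n → Seq n d t → ℕ → Set
HasAZeroSubseq {n} {d} {t} A g ℓ =
  Σ (Fin ℓ → Fin t) λ ι → Injective _≡_ _≡_ ι ×
    Σ (Fin ℓ → ℕ) λ a → (∀ j → mem A (a j)) × WeightedZero g ι a

DProp : (n d : ℕ) → WeightSet n → ℕ → Set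
DProp n d A t = (g : Seq n d t) → ∃ λ ℓ → 1 ≤ ℓ × HasAZeroSubseq A g ℓ

LenProp : (n d : ℕ) → WeightSet n → ℕ → ℕ → Set
LenProp n d A m t = (g : Seq n d t) → HasAZeroSubseq A g m

IsLeastPos : (ℕ → Set) → ℕ → Set
IsLeastPos P t = 1 ≤ t × P t × (∀ u → 1 ≤ u → P u → t ≤ u)

-- d_A(G), s_A(G), ZS_A(G) for G = ℤ_n^d, specified as "x is the value of".
IsDA : (n d : ℕ) → WeightSet n → ℕ → Set
IsDA n d A = IsLeastPos (DProp n d A)

IsSA : (n d : ℕ) → WeightSet n → ℕ → Set
IsSA n d A = IsLeastPos (LenProp n d A n)

IsZSA : (n d : ℕ) → WeightSet n → ℕ → Set
IsZSA n d A = IsLeastPos (LenProp n d A (n ^ d))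

{-# OPTIONS --safe #-}
module Submission where

-- Upper bound: write d_A − 1 + n^d = (s_A − n) + n · n^(d−1). In a sequence of that length,
-- zero-sum subsequences of length n can be chosen greedily on pairwise disjoint index sets:
-- while fewer than n^(d−1) of them have been chosen, at least s_A indices are still unused.
-- Their union is a zero-sum subsequence of length n^d.
-- Lower bound: pad a sequence of length ZS_A − n^d + 1 with n^d − 1 zeros. A zero-sum
-- subsequence of length n^d must use one of the original terms, and dropping the zeros from it
-- leaves a nonempty zero-sum subsequence of the original sequence; so d_A ≤ ZS_A − n^d + 1.

open import Defs
open import Data.Nat using (ℕ; zero; suc; _+_; _*_; _∸_; _^_; _≤_; z≤n; s≤s)
open import Data.Nat.Properties
open import Data.Nat.Divisibility using (_∣_; ∣m∣n⇒∣m+n; _∣0)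
open import Data.Nat.Tactic.RingSolver using (solve-∀)
open import Data.Fin as F using (Fin; toℕ; _↑ˡ_; _↑ʳ_; inject≤; splitAt)
import Data.Fin.Properties as FP
open import Data.Bool using (Bool; true; false; not)
open import Data.Bool.Properties using (not-injective)
open import Data.Product using (∃; _×_; _,_; proj₁; proj₂)
open import Data.Sum using (_⊎_; inj₁; inj₂; map₂; [_,_])
open import Function using (_∘_)
open import Function.Definitions using (Injective)
open import Relation.Nullary using (yes; no; contradiction)
open import Relation.Binary.PropositionalEquality hiding ([_])
open import Algebra.Properties.CommutativeSemigroup +-commutativeSemigroup using (interchange)

Σ-cong : ∀ m {f g : Fin m → ℕ} → (∀ i → f i ≡ g i) → Σ[< m ] f ≡ Σ[< m ] g
Σ-cong zero    f≗g = refl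
Σ-cong (suc m) f≗g = cong₂ _+_ (f≗g F.zero) (Σ-cong m (f≗g ∘ F.suc))

Σ-zero : ∀ m {f : Fin m → ℕ} → (∀ i → f i ≡ 0) → Σ[< m ] f ≡ 0
Σ-zero zero    f≗0 = refl
Σ-zero (suc m) f≗0 = cong₂ _+_ (f≗0 F.zero) (Σ-zero m (f≗0 ∘ F.suc))

Σ-+ : ∀ m (f g : Fin m → ℕ) → Σ[< m ] (λ i → f i + g i) ≡ Σ[< m ] f + Σ[< m ] g
Σ-+ zero    f g = refl
Σ-+ (suc m) f g = trans (cong (f F.zero + g F.zero +_) (Σ-+ m (f ∘ F.suc) (g ∘ F.suc)))
  (interchange (f F.zero) (g F.zero) (Σ[< m ] (f ∘ F.suc)) (Σ[< m ] (g ∘ F.suc)))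

Σ-+-* : ∀ m (f g y : Fin m → ℕ) →
  Σ[< m ] (λ i → (f i + g i) * y i) ≡ Σ[< m ] (λ i → f i * y i) + Σ[< m ] (λ i → g i * y i)
Σ-+-* m f g y = trans (Σ-cong m (λ i → *-distribʳ-+ (y i) (f i) (g i))) (Σ-+ m _ _)

Σ-↑ : ∀ m k (f : Fin (m + k) → ℕ) →
  Σ[< m + k ] f ≡ Σ[< m ] (f ∘ (_↑ˡ k)) + Σ[< k ] (f ∘ (m ↑ʳ_))
Σ-↑ zero    k f = refl
Σ-↑ (suc m) k f = trans (cong (f F.zero +_) (Σ-↑ m k (f ∘ F.suc))) (sym (+-assoc (f F.zero) _ _))

fromBool : Bool → ℕ
fromBool true  = 1
fromBool false = 0

count : ∀ {t} → (Fin t → Bool) → ℕ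
count {t} p = Σ[< t ] (fromBool ∘ p)

count-≤ : ∀ {t} (p : Fin t → Bool) → count p ≤ t
count-≤ {zero}  p = z≤n
count-≤ {suc t} p with p F.zero
... | true  = s≤s (count-≤ (p ∘ F.suc))
... | false = m≤n⇒m≤1+n (count-≤ (p ∘ F.suc))

count-+-count-not : ∀ {t} (p : Fin t → Bool) → count p + count (not ∘ p) ≡ t
count-+-count-not {zero}  p = refl
count-+-count-not {suc t} p with p F.zero
... | true  = cong suc (count-+-count-not (p ∘ F.suc))
... | false = trans (+-suc _ _) (cong suc (count-+-count-not (p ∘ F.suc)))

enumerate : ∀ {t} (p : Fin t → Bool) → Fin (count p) → Fin t
enumerate {suc t} p i with p F.zero
enumerate {suc t} p F.zero    | true  = F.zero
enumerate {suc t} p (F.suc i) | true  = F.suc (enumerate (p ∘ F.suc) i)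
enumerate {suc t} p i         | false = F.suc (enumerate (p ∘ F.suc) i)

enumerate-true : ∀ {t} (p : Fin t → Bool) i → p (enumerate p i) ≡ true
enumerate-true {suc t} p i with p F.zero in p0≡b
enumerate-true {suc t} p F.zero    | true  = p0≡b
enumerate-true {suc t} p (F.suc i) | true  = enumerate-true (p ∘ F.suc) i
enumerate-true {suc t} p i         | false = enumerate-true (p ∘ F.suc) i

enumerate-injective : ∀ {t} (p : Fin t → Bool) → Injective _≡_ _≡_ (enumerate p)
enumerate-injective {suc t} p {i} {j} eq with p F.zero
enumerate-injective {suc t} p {F.zero}  {F.zero}  eq | true = refl
enumerate-injective {suc t} p {F.suc i} {F.suc j} eq | true =
  cong F.suc (enumerate-injective (p ∘ F.suc) (FP.suc-injective eq))
enumerate-injective {suc t} p {i} {j} eq | false =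
  enumerate-injective (p ∘ F.suc) (FP.suc-injective eq)

Σ-enumerate : ∀ {t} (p : Fin t → Bool) (f : Fin t → ℕ) → (∀ i → p i ≡ false → f i ≡ 0) →
  Σ[< count p ] (f ∘ enumerate p) ≡ Σ[< t ] f
Σ-enumerate {zero}  p f f≗0 = refl
Σ-enumerate {suc t} p f f≗0 with p F.zero in p0≡b
... | true  = cong (f F.zero +_) (Σ-enumerate (p ∘ F.suc) (f ∘ F.suc) (f≗0 ∘ F.suc))
... | false = trans (Σ-enumerate (p ∘ F.suc) (f ∘ F.suc) (f≗0 ∘ F.suc))
  (cong (_+ Σ[< t ] (f ∘ F.suc)) (sym (f≗0 F.zero p0≡b)))

unused-indices : ∀ {s t} (p : Fin t → Bool) → count p + s ≤ t →
  ∃ λ (e : Fin s → Fin t) → Injective _≡_ _≡_ e × (∀ j → p (e j) ≡ false)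
unused-indices p p+s≤t = e , e-injective , λ j → not-injective (enumerate-true (not ∘ p) _)
  where
  s≤unused : _ ≤ count (not ∘ p)
  s≤unused = +-cancelˡ-≤ (count p) _ _ (≤-trans p+s≤t (≤-reflexive (sym (count-+-count-not p))))
  e : Fin _ → Fin _
  e j = enumerate (not ∘ p) (inject≤ j s≤unused)
  e-injective : Injective _≡_ _≡_ e
  e-injective {i} {j} eq = FP.inject≤-injective s≤unused s≤unused i j (enumerate-injective (not ∘ p) eq)

single : ∀ {t} → Fin t → ℕ → Fin t → ℕ
single F.zero    c F.zero    = c
single F.zero    c (F.suc j) = 0
single (F.suc i) c F.zero    = 0
single (F.suc i) c (F.suc j) = single i c j

single-≡ : ∀ {t} (i : Fin t) c → single i c i ≡ c
single-≡ F.zero    c = refl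
single-≡ (F.suc i) c = single-≡ i c

single-≢ : ∀ {t} {i j : Fin t} c → i ≢ j → single i c j ≡ 0
single-≢ {i = F.zero}  {F.zero}  c i≢j = contradiction refl i≢j
single-≢ {i = F.zero}  {F.suc j} c i≢j = refl
single-≢ {i = F.suc i} {F.zero}  c i≢j = refl
single-≢ {i = F.suc i} {F.suc j} c i≢j = single-≢ c (i≢j ∘ cong F.suc)

Σ-single-* : ∀ {t} (i : Fin t) c (y : Fin t → ℕ) → Σ[< t ] (λ j → single i c j * y j) ≡ c * y i
Σ-single-* {suc t} F.zero    c y = trans (cong (c * y F.zero +_) (Σ-zero t (λ _ → refl))) (+-identityʳ _)
Σ-single-* {suc t} (F.suc i) c y = Σ-single-* i c (y ∘ F.suc)

nonzero : ℕ → Bool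
nonzero zero    = false
nonzero (suc _) = true

nonzero-false : ∀ {x} → nonzero x ≡ false → x ≡ 0
nonzero-false {zero} _ = refl

count-single-+ : ∀ {t} (i : Fin t) {c} (f : Fin t → ℕ) → f i ≡ 0 → 1 ≤ c →
  count (λ j → nonzero (single i c j + f j)) ≡ suc (count (nonzero ∘ f))
count-single-+ F.zero    {suc c} f fi≡0 _ rewrite fi≡0 = refl
count-single-+ (F.suc i) f fi≡0 1≤c =
  trans (cong (fromBool (nonzero (f F.zero)) +_) (count-single-+ i (f ∘ F.suc) fi≡0 1≤c)) (+-suc _ _)

scatter : ∀ {ℓ t} → (Fin ℓ → Fin t) → (Fin ℓ → ℕ) → Fin t → ℕ
scatter {zero}  ψ a i = 0
scatter {suc ℓ} ψ a i = single (ψ F.zero) (a F.zero) i + scatter (ψ ∘ F.suc) (a ∘ F.suc) i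

scatter-∉ : ∀ {ℓ t} {ψ : Fin ℓ → Fin t} (a : Fin ℓ → ℕ) {i} → (∀ j → ψ j ≢ i) → scatter ψ a i ≡ 0
scatter-∉ {zero}  a i∉ψ = refl
scatter-∉ {suc ℓ} a i∉ψ = cong₂ _+_ (single-≢ (a F.zero) (i∉ψ F.zero)) (scatter-∉ (a ∘ F.suc) (i∉ψ ∘ F.suc))

scatter-values : ∀ {ℓ t} {ψ : Fin ℓ → Fin t} (a : Fin ℓ → ℕ) → Injective _≡_ _≡_ ψ →
  ∀ i → scatter ψ a i ≡ 0 ⊎ ∃ λ j → scatter ψ a i ≡ a j
scatter-values {zero}          a ψ-inj i = inj₁ refl
scatter-values {suc ℓ} {ψ = ψ} a ψ-inj i with ψ F.zero FP.≟ i
... | yes refl = inj₂ (F.zero , (begin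
  single (ψ F.zero) (a F.zero) (ψ F.zero) + scatter (ψ ∘ F.suc) (a ∘ F.suc) (ψ F.zero)
    ≡⟨ cong₂ _+_ (single-≡ (ψ F.zero) (a F.zero)) (scatter-∉ (a ∘ F.suc) (λ j → FP.0≢1+n ∘ ψ-inj ∘ sym)) ⟩
  a F.zero + 0
    ≡⟨ +-identityʳ (a F.zero) ⟩
  a F.zero ∎))
  where open ≡-Reasoning
... | no ψ0≢i rewrite single-≢ (a F.zero) ψ0≢i with scatter-values (a ∘ F.suc) (FP.suc-injective ∘ ψ-inj) i
...   | inj₁ eq₀       = inj₁ eq₀
...   | inj₂ (j , eq)   = inj₂ (F.suc j , eq)

count-scatter : ∀ {ℓ t} {ψ : Fin ℓ → Fin t} {a : Fin ℓ → ℕ} → (∀ j → 1 ≤ a j) → Injective _≡_ _≡_ ψ →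
  count (nonzero ∘ scatter ψ a) ≡ ℓ
count-scatter {zero}  {t}             a≥1 ψ-inj = Σ-zero t (λ _ → refl)
count-scatter {suc ℓ} {ψ = ψ} {a} a≥1 ψ-inj = begin
  count (λ i → nonzero (single (ψ F.zero) (a F.zero) i + scatter (ψ ∘ F.suc) (a ∘ F.suc) i))
    ≡⟨ count-single-+ (ψ F.zero) _ (scatter-∉ (a ∘ F.suc) (λ j → FP.0≢1+n ∘ ψ-inj ∘ sym)) (a≥1 F.zero) ⟩
  suc (count (nonzero ∘ scatter (ψ ∘ F.suc) (a ∘ F.suc)))
    ≡⟨ cong suc (count-scatter (a≥1 ∘ F.suc) (FP.suc-injective ∘ ψ-inj)) ⟩
  suc ℓ ∎
  where open ≡-Reasoning

Σ-scatter-* : ∀ {ℓ t} (ψ : Fin ℓ → Fin t) (a : Fin ℓ → ℕ) (y : Fin t → ℕ) →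
  Σ[< t ] (λ i → scatter ψ a i * y i) ≡ Σ[< ℓ ] (λ j → a j * y (ψ j))
Σ-scatter-* {zero}  {t} ψ a y = Σ-zero t (λ _ → refl)
Σ-scatter-* {suc ℓ} {t} ψ a y = begin
  Σ[< t ] (λ i → (single (ψ F.zero) (a F.zero) i + scatter (ψ ∘ F.suc) (a ∘ F.suc) i) * y i)
    ≡⟨ Σ-+-* t (single (ψ F.zero) (a F.zero)) (scatter (ψ ∘ F.suc) (a ∘ F.suc)) y ⟩
  Σ[< t ] (λ i → single (ψ F.zero) (a F.zero) i * y i) + Σ[< t ] (λ i → scatter (ψ ∘ F.suc) (a ∘ F.suc) i * y i)
    ≡⟨ cong₂ _+_ (Σ-single-* (ψ F.zero) (a F.zero) y) (Σ-scatter-* (ψ ∘ F.suc) (a ∘ F.suc) y) ⟩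
  a F.zero * y (ψ F.zero) + Σ[< ℓ ] (λ j → a (F.suc j) * y (ψ (F.suc j))) ∎
  where open ≡-Reasoning

module _ {n d : ℕ} (A : WeightSet n) where

  -- A weighted subsequence is recorded as a weight vector on all indices, weight 0 meaning
  -- "not chosen"; disjoint unions and restrictions of subsequences become pointwise operations.
  record IsZeroSumWeighting {t} (g : Seq n d t) (ℓ : ℕ) (w : Fin t → ℕ) : Set where
    field
      weight∈A     : ∀ i → w i ≡ 0 ⊎ mem A (w i)
      support-size : count (nonzero ∘ w) ≡ ℓ
      zero-sum     : WeightedZero g (λ i → i) w

  subseq⇒weighting : ∀ {t ℓ} {g : Seq n d t} (ι : Fin ℓ → Fin t) → Injective _≡_ _≡_ ι →
    (a : Fin ℓ → ℕ) → (∀ j → mem A (a j)) → WeightedZero g ι a → IsZeroSumWeighting g ℓ (scatter ι a)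
  subseq⇒weighting {g = g} ι ι-inj a a∈A zs = record
    { weight∈A     = λ i → map₂ (λ (j , eq) → subst (mem A) (sym eq) (a∈A j)) (scatter-values a ι-inj i)
    ; support-size = count-scatter (λ j → proj₁ (inRange A (a j) (a∈A j))) ι-inj
    ; zero-sum     = λ k → subst (n ∣_) (sym (Σ-scatter-* ι a (λ i → toℕ (g i k)))) (zs k)
    }

  weighting⇒subseq : ∀ {t ℓ w} {g : Seq n d t} → IsZeroSumWeighting g ℓ w → HasAZeroSubseq A g ℓ
  weighting⇒subseq {t} {w = w} {g} record { weight∈A = weight∈A ; support-size = refl ; zero-sum = zero-sum } =
    enumerate support , enumerate-injective support , w ∘ enumerate support , chosen∈A ,
    λ k → subst (n ∣_) (sym (Σ-enumerate support _ (λ i wi≡0 → cong (_* toℕ (g i k)) (nonzero-false wi≡0))))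
                (zero-sum k)
    where
    support = nonzero ∘ w
    chosen∈A : ∀ j → mem A (w (enumerate support j))
    chosen∈A j with weight∈A (enumerate support j)
    ... | inj₂ w∈A = w∈A
    ... | inj₁ w≡0 = contradiction (trans (cong nonzero (sym w≡0)) (enumerate-true support j)) λ ()

  zero-weighting : ∀ {t} (g : Seq n d t) → IsZeroSumWeighting g 0 (λ _ → 0)
  zero-weighting {t} g = record
    { weight∈A     = λ _ → inj₁ refl
    ; support-size = Σ-zero t (λ _ → refl)
    ; zero-sum     = λ k → subst (n ∣_) (sym (Σ-zero t (λ _ → refl))) (n ∣0)
    }

  +-weighting : ∀ {t ℓ₁ ℓ₂ w₁ w₂} {g : Seq n d t} → (∀ i → w₁ i ≡ 0 ⊎ w₂ i ≡ 0) →
    IsZeroSumWeighting g ℓ₁ w₁ → IsZeroSumWeighting g ℓ₂ w₂ →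
    IsZeroSumWeighting g (ℓ₁ + ℓ₂) (λ i → w₁ i + w₂ i)
  +-weighting {t} {w₁ = w₁} {w₂} {g} disjoint W₁ W₂ = record
    { weight∈A     = sum-weight∈A
    ; support-size = trans (Σ-cong t (λ i → fromBool-nonzero-+ (disjoint i)))
                           (trans (Σ-+ t _ _) (cong₂ _+_ (support-size W₁) (support-size W₂)))
    ; zero-sum     = λ k → subst (n ∣_) (sym (Σ-+-* t w₁ w₂ (λ i → toℕ (g i k))))
                                 (∣m∣n⇒∣m+n (zero-sum W₁ k) (zero-sum W₂ k))
    }
    where
    open IsZeroSumWeighting
    sum-weight∈A : ∀ i → w₁ i + w₂ i ≡ 0 ⊎ mem A (w₁ i + w₂ i)
    sum-weight∈A i with disjoint i
    ... | inj₁ w₁≡0 rewrite w₁≡0 = weight∈A W₂ i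
    ... | inj₂ w₂≡0 rewrite w₂≡0 | +-identityʳ (w₁ i) = weight∈A W₁ i
    fromBool-nonzero-+ : ∀ {x y} → x ≡ 0 ⊎ y ≡ 0 →
      fromBool (nonzero (x + y)) ≡ fromBool (nonzero x) + fromBool (nonzero y)
    fromBool-nonzero-+         (inj₁ refl) = refl
    fromBool-nonzero-+ {x} {y} (inj₂ refl) rewrite +-identityʳ x = sym (+-identityʳ _)

  extend-weighting : ∀ {m s t ℓ w} {g : Seq n d t} → LenProp n d A m s → IsZeroSumWeighting g ℓ w → ℓ + s ≤ t →
    ∃ (IsZeroSumWeighting g (m + ℓ))
  extend-weighting {w = w} {g} P W ℓ+s≤t
    with unused-indices (nonzero ∘ w) (subst (λ c → c + _ ≤ _) (sym (IsZeroSumWeighting.support-size W)) ℓ+s≤t)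
  ... | e , e-inj , unused with P (g ∘ e)
  ... | ι , ι-inj , a , a∈A , zs =
    _ , +-weighting disjoint (subseq⇒weighting (e ∘ ι) (ι-inj ∘ e-inj) a a∈A zs) W
    where
    disjoint : ∀ i → scatter (e ∘ ι) a i ≡ 0 ⊎ w i ≡ 0
    disjoint i with w i in wi≡1+x
    ... | zero  = inj₂ refl
    ... | suc _ = inj₁ (scatter-∉ a λ j eιj≡i →
      0≢1+n (trans (sym (nonzero-false (subst (λ x → nonzero (w x) ≡ false) eιj≡i (unused (ι j))))) wi≡1+x))

  LenProp-blocks : ∀ {m r} → LenProp n d A m (r + m) → ∀ k → 1 ≤ k → LenProp n d A (m * k) (r + m * k)
  LenProp-blocks {m} {r} P (suc k) _ g =
    weighting⇒subseq (proj₂ (subst (∃ ∘ IsZeroSumWeighting g) (*-comm (suc k) m)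
                                   (blocks k (≤-reflexive (length-identity k m r)))))
    where
    blocks : ∀ j → j * m + (r + m) ≤ r + m * suc k → ∃ (IsZeroSumWeighting g (suc j * m))
    blocks zero    fits = extend-weighting P (zero-weighting g) fits
    blocks (suc j) fits = extend-weighting P (proj₂ (blocks j (≤-trans (+-monoˡ-≤ (r + m) (m≤n+m (j * m) m)) fits))) fits
    length-identity : ∀ k m r → k * m + (r + m) ≡ r + m * suc k
    length-identity = solve-∀

  restrict-weighting : ∀ {t m ℓ w} {g : Seq n d (t + m)} {h : Seq n d t} →
    (∀ j → g (j ↑ˡ m) ≡ h j) → (∀ j k → toℕ (g (t ↑ʳ j) k) ≡ 0) → IsZeroSumWeighting g ℓ w →
    IsZeroSumWeighting h (count (nonzero ∘ w ∘ (_↑ˡ m))) (w ∘ (_↑ˡ m))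
  restrict-weighting {t} {m} {w = w} {g} {h} g∘↑ˡ≡h g∘↑ʳ≡0 W = record
    { weight∈A     = weight∈A ∘ (_↑ˡ m)
    ; support-size = refl
    ; zero-sum     = λ k → subst (n ∣_) (restricted-sum k) (zero-sum k)
    }
    where
    open IsZeroSumWeighting W
    restricted-sum : ∀ k → Σ[< t + m ] (λ i → w i * toℕ (g i k)) ≡ Σ[< t ] (λ j → w (j ↑ˡ m) * toℕ (h j k))
    restricted-sum k = begin
      Σ[< t + m ] (λ i → w i * toℕ (g i k))
        ≡⟨ Σ-↑ t m _ ⟩
      Σ[< t ] (λ j → w (j ↑ˡ m) * toℕ (g (j ↑ˡ m) k)) + Σ[< m ] (λ j → w (t ↑ʳ j) * toℕ (g (t ↑ʳ j) k))
        ≡⟨ cong₂ _+_ (Σ-cong t λ j → cong (λ x → w (j ↑ˡ m) * toℕ (x k)) (g∘↑ˡ≡h j))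
                     (Σ-zero m λ j → trans (cong (w (t ↑ʳ j) *_) (g∘↑ʳ≡0 j k)) (*-zeroʳ (w (t ↑ʳ j)))) ⟩
      Σ[< t ] (λ j → w (j ↑ˡ m) * toℕ (h j k)) + 0
        ≡⟨ +-identityʳ _ ⟩
      Σ[< t ] (λ j → w (j ↑ˡ m) * toℕ (h j k)) ∎
      where open ≡-Reasoning

module _ {n d : ℕ} {A : WeightSet (suc n)} where

  LenProp⇒≤ : ∀ {m t} → LenProp (suc n) d A m t → m ≤ t
  LenProp⇒≤ P = FP.injective⇒≤ (proj₁ (proj₂ (P (λ _ _ → F.zero))))

  pad : ∀ {t} m → Seq (suc n) d t → Seq (suc n) d (t + m)
  pad {t} m h i = [ h , (λ _ _ → F.zero) ] (splitAt t i)

  pad-↑ˡ : ∀ {t} m (h : Seq (suc n) d t) j → pad m h (j ↑ˡ m) ≡ h j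
  pad-↑ˡ {t} m h j rewrite FP.splitAt-↑ˡ t j m = refl

  pad-↑ʳ : ∀ {t} m (h : Seq (suc n) d t) j k → toℕ (pad m h (t ↑ʳ j) k) ≡ 0
  pad-↑ʳ {t} m h j k rewrite FP.splitAt-↑ʳ t m j = refl

  LenProp-padded⇒DProp : ∀ {t m} → LenProp (suc n) d A (suc m) (t + m) → DProp (suc n) d A t
  LenProp-padded⇒DProp {t} {m} P h with P (pad m h)
  ... | ι , ι-inj , a , a∈A , zs =
    count (nonzero ∘ w ∘ (_↑ˡ m)) , uses-h , weighting⇒subseq A (restrict-weighting A (pad-↑ˡ m h) (pad-↑ʳ m h) W)
    where
    w = scatter ι a
    W = subseq⇒weighting A {g = pad m h} ι ι-inj a a∈A zs
    uses-h : 1 ≤ count (nonzero ∘ w ∘ (_↑ˡ m))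
    uses-h = +-cancelʳ-≤ m 1 _ (begin
      suc m
        ≡⟨ IsZeroSumWeighting.support-size W ⟨
      count (nonzero ∘ w)
        ≡⟨ Σ-↑ t m (fromBool ∘ nonzero ∘ w) ⟩
      count (nonzero ∘ w ∘ (_↑ˡ m)) + count (nonzero ∘ w ∘ (t ↑ʳ_))
        ≤⟨ +-monoʳ-≤ (count (nonzero ∘ w ∘ (_↑ˡ m))) (count-≤ (nonzero ∘ w ∘ (t ↑ʳ_))) ⟩
      count (nonzero ∘ w ∘ (_↑ˡ m)) + m ∎)
      where open ≤-Reasoning

  LenProp⇒dA+m∸1≤ : ∀ {dA m t} → IsDA (suc n) d A dA → LenProp (suc n) d A m t → 1 ≤ m → dA + m ∸ 1 ≤ t
  LenProp⇒dA+m∸1≤ {suc D} {suc m} {t} (_ , _ , dA-least) P _ = begin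
    D + suc m        ≡⟨ +-suc D m ⟩
    suc D + m        ≤⟨ +-monoˡ-≤ m (dA-least (t ∸ m) (m<n⇒0<n∸m m<t) (LenProp-padded⇒DProp P′)) ⟩
    t ∸ m + m        ≡⟨ m∸n+n≡m (<⇒≤ m<t) ⟩
    t                ∎
    where
    open ≤-Reasoning
    m<t = LenProp⇒≤ P
    P′ : LenProp (suc n) d A (suc m) (t ∸ m + m)
    P′ = subst (LenProp (suc n) d A (suc m)) (sym (m∸n+n≡m (<⇒≤ m<t))) P

lemma3p1 : (n d : ℕ) → 2 ≤ n → 1 ≤ d → (A : WeightSet n) →
    (dA sA zsA : ℕ) → IsDA n d A dA → IsSA n d A sA → IsZSA n d A zsA →
    sA ≡ dA + n ∸ 1 →
    zsA ≡ dA + n ^ d ∸ 1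
lemma3p1 (suc n) (suc d) _ _ A (suc D) .(suc D + suc n ∸ 1) zsA
         isDA (_ , sA-prop , _) (_ , zsA-prop , zsA-least) refl =
  ≤-antisym
    (zsA-least _ (≤-trans (m^n>0 (suc n) (suc d)) (m≤n+m _ D))
               (LenProp-blocks A sA-prop (suc n ^ d) (m^n>0 (suc n) d)))
    (LenProp⇒dA+m∸1≤ {A = A} isDA zsA-prop (m^n>0 (suc n) (suc d)))
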